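{- Let $\mathcal{U}_n$ be the set of isomorphism classes of unit interval orders with $n$ elements and $\mathcal{P}_n$ the set of unit interval positroids on $[2n]$. The map $\mathcal{U}_n\to\mathcal{P}_n$ sending (the class of) a unit interval order $P$ to the unit interval positroid induced by $P$ is a bijection.
   Context: A poset $P$ is a unit interval order if there is a bijection $i\mapsto[q_i,q_i+1]$ to closed unit intervals of $\mathbb{R}$ with $i<_P j$ iff $q_i+1<q_j$. For a poset labeled bijectively by $[n]$, the altitude of $i$ is $\alpha(i)=|\{j: j\le_P i\}|-|\{j: i\le_P j\}|$; the labeling is canonical if $\alpha(i)<\alpha(j)$ implies $i<j$. The antiadjacency matrix is the $n\times n$ $0/1$ matrix $(a_{i,j})$ with $a_{i,j}=0$ iff $i<_P j$; isomorphic canonically labeled unit interval orders have the same antiadjacency matrix. For an $n\times n$ matrix $A=(a_{i,j})$, $\psi(A)$ is the $n\times 2n$ matrix whose first $n$ columns form $I_n$ and whose column $n+j$ has entry $(-1)^{n-i}a_{n+1-i,j}$ in row $i$. The unit interval positroid induced by $P$ is the matroid on $[2n]$ whose bases are the $n$-subsets indexing linearly independent columns of $\psi(A)$, where $A$ is the antiadjacency matrix of $P$ under a canonical labeling; $\mathcal{P}_n$ is the set of all matroids arising this way from unit interval orders on $n$ elements.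
   Formalization: The endpoints $q_i$ in the unit interval representation of a unit interval order are rational numbers rather than arbitrary reals. -}

module Defs where

open import Data.Nat using (ℕ; zero; suc; _+_)
open import Data.Bool using (Bool; true; false; if_then_else_; _∨_)
open import Data.Fin using (Fin; zero; suc; toℕ; splitAt; opposite; _≟_)
import Data.Fin as F
open import Data.Fin.Subset using (Subset; _∈_; _∉_; ∣_∣)
open import Data.Sum using (_⊎_; inj₁; inj₂)
open import Data.Product using (Σ; ∃; _×_; _,_)
open import Data.Integer using (ℤ; _-_; +_)
import Data.Integer as ℤ
open import Data.Rational using (ℚ; 0ℚ; 1ℚ; _<_; -_)
import Data.Rational as Q
open import Relation.Nullary.Decidable using (⌊_⌋)
open import Relation.Binary.PropositionalEquality using (_≡_)
open import Function.Bundles using (_⇔_; _↔_; Inverse)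

-- A (strict) order on the label set [n] = Fin n, given as a Boolean
-- relation: R i j ≡ true  means  i <_P j.
Rel : ℕ → Set
Rel n = Fin n → Fin n → Bool

IsUnitIntervalOrder : ∀ {n} → Rel n → Set
IsUnitIntervalOrder {n} R =
  Σ (Fin n → ℚ) λ q → ∀ i j → (R i j ≡ true) ⇔ ((q i Q.+ 1ℚ) < q j)

Iso : ∀ {n} → Rel n → Rel n → Set
Iso {n} R R' = Σ (Fin n ↔ Fin n) λ σ →
  ∀ i j → R i j ≡ R' (Inverse.to σ i) (Inverse.to σ j)

count : ∀ {m} → (Fin m → Bool) → ℕ
count {zero}  p = 0
count {suc m} p = (if p zero then 1 else 0) + count (λ k → p (suc k))

leP : ∀ {n} → Rel n → Fin n → Fin n → Bool
leP R j i = ⌊ j ≟ i ⌋ ∨ R j i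

altitude : ∀ {n} → Rel n → Fin n → ℤ
altitude R i = + count (λ j → leP R j i) - + count (λ j → leP R i j)

Canonical : ∀ {n} → Rel n → Set
Canonical R = ∀ i j → altitude R i ℤ.< altitude R j → i F.< j

antiadj : ∀ {n} → Rel n → Fin n → Fin n → ℚ
antiadj R i j = if R i j then 0ℚ else 1ℚ

negOnePow : ℕ → ℚ
negOnePow zero    = 1ℚ
negOnePow (suc k) = - negOnePow k

-- ψ(A): n × 2n matrix. 0-indexed: columns k < n form I_n; column n+j has
-- in row i the entry (-1)^{n-1-i} a_{n-1-i, j}  (= (-1)^{n-i'} a_{n+1-i',j}
-- with 1-indexed i' = i+1). Note toℕ (opposite i) = n-1-i.
ψ : ∀ {n} → (Fin n → Fin n → ℚ) → Fin n → Fin (n + n) → ℚ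
ψ {n} A i c with splitAt n c
... | inj₁ k = if ⌊ i ≟ k ⌋ then 1ℚ else 0ℚ
... | inj₂ j = negOnePow (toℕ (opposite i)) Q.* A (opposite i) j

sumℚ : ∀ {m} → (Fin m → ℚ) → ℚ
sumℚ {zero}  f = 0ℚ
sumℚ {suc m} f = f zero Q.+ sumℚ (λ k → f (suc k))

LinIndepCols : ∀ {n m} → (Fin n → Fin m → ℚ) → Subset m → Set
LinIndepCols {n} {m} M S = (c : Fin m → ℚ) →
  (∀ k → k ∉ S → c k ≡ 0ℚ) →
  (∀ i → sumℚ (λ k → c k Q.* M i k) ≡ 0ℚ) →
  ∀ k → c k ≡ 0ℚ

-- a matroid on [2n], given by its set of bases
Matroid : ℕ → Set₁
Matroid n = Subset (n + n) → Set

SameMatroid : ∀ n → Matroid n → Matroid n → Set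
SameMatroid n M N = ∀ S → M S ⇔ N S

positroid : ∀ {n} → Rel n → Matroid n
positroid {n} R S = (∣ S ∣ ≡ n) × LinIndepCols (ψ (antiadj R)) S

InP : (n : ℕ) → Matroid n → Set
InP n M = Σ (Rel n) λ R →
  IsUnitIntervalOrder R × Canonical R × SameMatroid n (positroid R) M

{-# OPTIONS --safe #-}
-- In a unit interval order the strict down-set of x grows and its strict up-set shrinks as
-- the interval of x moves right, so two elements of equal altitude have the same down-set
-- and the same up-set. Sorting by altitude gives a canonical labeling. An isomorphism of
-- canonically labeled orders preserves altitude, and two sorted altitude sequences that are
-- permutations of each other coincide; so the isomorphism only moves elements to such twins
-- and the two labeled orders are equal. Conversely ψ(A) = [ I ∣ B ] with B r j = ±a_{n+1-r,j},
-- and ([n] ∖ {r}) ∪ {n + j} is a basis exactly when B r j ≠ 0, so the positroid recovers the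
-- zero pattern of A, which is the order.
module Submission where

open import Defs
open import Data.Nat using (ℕ)
open import Data.Product using (Σ; _×_)
open import Function.Bundles using (_⇔_)

import Data.Nat.Properties as ℕP
open import Algebra.Properties.CommutativeMonoid.Sum ℕP.+-0-commutativeMonoid using (sum; sum-permute)
open import Data.Bool using (Bool; true; false; _∨_; if_then_else_)
open import Data.Bool.Properties using (¬-not; not-¬)
open import Data.Fin as F using (Fin; zero; suc; toℕ; splitAt; _↑ˡ_; _↑ʳ_; opposite; _≟_)
import Data.Fin.Properties as FP
open import Data.Fin.Permutation as Perm using (Permutation; _⟨$⟩ʳ_; _∘ₚ_)
open import Data.Fin.Subset using (Subset; _∈_; _∉_; ∣_∣; ⁅_⁆; ∁; inside; outside)
open import Data.Fin.Subset.Properties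
  using (x∈⁅x⁆; x∈⁅y⁆⇒x≡y; x∉⁅y⁆⇒x≢y; x∈∁p⇒x∉p; x∉∁p⇒x∈p; ∣∁p∣≡n∸∣p∣; ∣⁅x⁆∣≡1)
open import Data.Integer as ℤ using (_⊖_)
import Data.Integer.Properties as ℤP
open import Data.Nat as ℕ using (zero; suc; z≤n; s≤s)
open import Data.Product using (∃; _,_; proj₁; proj₂; map₂)
open import Data.Rational as ℚ using (ℚ; 0ℚ; 1ℚ)
import Data.Rational.Properties as ℚP
open import Data.Sum using (inj₁; inj₂)
import Data.Vec as Vec
import Data.Vec.Properties as VecP
import Data.Vec.Functional as VF
import Data.Vec.Functional.Properties as VFP
open import Function.Base using (_∘_)
open import Function.Bundles using (Equivalence; Injection; mk⇔)
import Function.Properties.Equivalence as ⇔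
open import Function.Properties.Inverse using (↔⇒↣)
open import Relation.Binary.Bundles using (DecTotalOrder)
open import Relation.Binary.Core using (_Preserves_⟶_)
open import Relation.Binary.PropositionalEquality
  using (_≡_; _≢_; refl; sym; trans; cong; cong₂; subst; subst₂; module ≡-Reasoning)
open import Relation.Nullary using (¬_; Dec; yes; no; contradiction)
open import Relation.Nullary.Decidable using (⌊_⌋; isYes≗does; does-⇔; ⌊⌋-map′)

private
  variable
    n m : ℕ

Bool-≡ : ∀ {a b : Bool} c → (a ≡ c ⇔ b ≡ c) → a ≡ b
Bool-≡ {false} {false} _     _ = refl
Bool-≡ {true}  {true}  _     _ = refl
Bool-≡ {false} {true}  false h with () ← Equivalence.to h refl
Bool-≡ {false} {true}  true  h with () ← Equivalence.from h refl
Bool-≡ {true}  {false} false h with () ← Equivalence.from h refl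
Bool-≡ {true}  {false} true  h with () ← Equivalence.to h refl

⌊⌋≡true⇔ : ∀ {a} {A : Set a} (a? : Dec A) → ⌊ a? ⌋ ≡ true ⇔ A
⌊⌋≡true⇔ (yes a) = mk⇔ (λ _ → a) (λ _ → refl)
⌊⌋≡true⇔ (no ¬a) = mk⇔ (λ ()) (λ a → contradiction a ¬a)

⌊⌋-⇔ : ∀ {a b} {A : Set a} {B : Set b} → A ⇔ B → (a? : Dec A) (b? : Dec B) → ⌊ a? ⌋ ≡ ⌊ b? ⌋
⌊⌋-⇔ A⇔B a? b? = trans (isYes≗does a?) (trans (does-⇔ A⇔B a? b?) (sym (isYes≗does b?)))

⌊≟⌋-sym : (i j : Fin n) → ⌊ i ≟ j ⌋ ≡ ⌊ j ≟ i ⌋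
⌊≟⌋-sym i j = ⌊⌋-⇔ (mk⇔ sym sym) (i ≟ j) (j ≟ i)

-- Counting

indicator : Bool → ℕ
indicator b = if b then 1 else 0

infix 4 _⊆ᵇ_

_⊆ᵇ_ : (Fin m → Bool) → (Fin m → Bool) → Set
p ⊆ᵇ q = ∀ i → p i ≡ true → q i ≡ true

count-cong : {p q : Fin m → Bool} → (∀ i → p i ≡ q i) → count p ≡ count q
count-cong {zero}  _   = refl
count-cong {suc m} p≗q = cong₂ ℕ._+_ (cong indicator (p≗q zero)) (count-cong (p≗q ∘ suc))

count≡sum : (p : Fin m → Bool) → count p ≡ sum (indicator ∘ p)
count≡sum {zero}  _ = refl
count≡sum {suc m} p = cong (indicator (p zero) ℕ.+_) (count≡sum (p ∘ suc))

count-permute : (p : Fin m → Bool) (π : Permutation m m) → count (p ∘ (π ⟨$⟩ʳ_)) ≡ count p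
count-permute p π = begin
  count (p ∘ (π ⟨$⟩ʳ_))           ≡⟨ count≡sum (p ∘ (π ⟨$⟩ʳ_)) ⟩
  sum (indicator ∘ p ∘ (π ⟨$⟩ʳ_)) ≡⟨ sum-permute (indicator ∘ p) π ⟨
  sum (indicator ∘ p)             ≡⟨ count≡sum p ⟨
  count p                         ∎
  where open ≡-Reasoning

count-none : {p : Fin m → Bool} → (∀ i → p i ≢ true) → count p ≡ 0
count-none {zero}          _    = refl
count-none {suc m} {p} none with p zero in p₀
... | true  = contradiction p₀ (none zero)
... | false = count-none (none ∘ suc)

indicator-mono : ∀ {a b} → (a ≡ true → b ≡ true) → indicator a ℕ.≤ indicator b
indicator-mono {false} _   = z≤n
indicator-mono {true}  a⇒b rewrite a⇒b refl = ℕP.≤-refl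

count-mono : {p q : Fin m → Bool} → p ⊆ᵇ q → count p ℕ.≤ count q
count-mono {zero}  _   = z≤n
count-mono {suc m} p⊆q = ℕP.+-mono-≤ (indicator-mono (p⊆q zero)) (count-mono (p⊆q ∘ suc))

count-mono-< : {p q : Fin m → Bool} → p ⊆ᵇ q →
               ∀ i → q i ≡ true → p i ≡ false → count p ℕ.< count q
count-mono-< {suc m} p⊆q zero qi pi rewrite qi | pi = s≤s (count-mono (p⊆q ∘ suc))
count-mono-< {suc m} p⊆q (suc i) qi pi =
  ℕP.+-mono-≤-< (indicator-mono (p⊆q zero)) (count-mono-< (p⊆q ∘ suc) i qi pi)

count-≡⇒⊇ : {p q : Fin m → Bool} → p ⊆ᵇ q → count p ≡ count q → q ⊆ᵇ p
count-≡⇒⊇ {p = p} p⊆q #p≡#q i qi with p i in pi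
... | true  = refl
... | false = contradiction #p≡#q (ℕP.<⇒≢ (count-mono-< p⊆q i qi pi))

count-insert : (p : Fin m → Bool) {i : Fin m} → p i ≡ false →
               count (λ j → ⌊ j ≟ i ⌋ ∨ p j) ≡ suc (count p)
count-insert {suc m} p {zero}  pi rewrite pi = refl
count-insert {suc m} p {suc i} pi = begin
  indicator (p zero) ℕ.+ count (λ j → ⌊ suc j ≟ suc i ⌋ ∨ p (suc j))
    ≡⟨ cong (indicator (p zero) ℕ.+_) (count-cong λ j → cong (_∨ p (suc j)) (⌊⌋-map′ _ _ (j ≟ i))) ⟩
  indicator (p zero) ℕ.+ count (λ j → ⌊ j ≟ i ⌋ ∨ p (suc j))
    ≡⟨ cong (indicator (p zero) ℕ.+_) (count-insert (p ∘ suc) pi) ⟩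
  indicator (p zero) ℕ.+ suc (count (p ∘ suc))
    ≡⟨ ℕP.+-suc (indicator (p zero)) (count (p ∘ suc)) ⟩
  suc (count p) ∎
  where open ≡-Reasoning

DownwardClosed : (Fin m → Bool) → Set
DownwardClosed p = ∀ {i j} → i F.≤ j → p j ≡ true → p i ≡ true

downwardClosed-count : {p : Fin m → Bool} → DownwardClosed p →
                       ∀ i → p i ≡ true ⇔ toℕ i ℕ.< count p
downwardClosed-count {suc m} {p} closed i with p zero in p₀
downwardClosed-count {suc m} {p} closed zero    | true  = mk⇔ (λ _ → s≤s z≤n) (λ _ → p₀)
downwardClosed-count {suc m} {p} closed (suc i) | true  =
  mk⇔ (s≤s ∘ Equivalence.to rest) (Equivalence.from rest ∘ ℕ.s≤s⁻¹)
  where rest = downwardClosed-count (closed ∘ s≤s) i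
downwardClosed-count {suc m} {p} closed i | false = mk⇔
  (λ pi → contradiction (trans (sym p₀) (closed z≤n pi)) λ ())
  (λ i<#p → contradiction (subst (toℕ i ℕ.<_) (count-none none) i<#p) ℕP.n≮0)
  where
  none : ∀ j → p (suc j) ≢ true
  none j pj = contradiction (trans (sym p₀) (closed z≤n pj)) λ ()

-- Altitude and unit interval orders

predecessors successors : Rel n → Fin n → ℕ
predecessors R i = count (λ j → R j i)
successors   R i = count (R i)

altitude-irreflexive : {R : Rel n} → (∀ i → R i i ≡ false) →
                       ∀ i → altitude R i ≡ predecessors R i ⊖ successors R i
altitude-irreflexive {R = R} irrefl i = begin
  ℤ.+ count (λ j → leP R j i) ℤ.- ℤ.+ count (λ j → leP R i j)
    ≡⟨ cong₂ (λ d u → ℤ.+ d ℤ.- ℤ.+ u) (count-insert (λ j → R j i) (irrefl i)) #up ⟩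
  ℤ.+ suc (predecessors R i) ℤ.- ℤ.+ suc (successors R i)
    ≡⟨ ℤP.[+m]-[+n]≡m⊖n (suc (predecessors R i)) (suc (successors R i)) ⟩
  suc (predecessors R i) ⊖ suc (successors R i)
    ≡⟨ ℤP.[1+m]⊖[1+n]≡m⊖n (predecessors R i) (successors R i) ⟩
  predecessors R i ⊖ successors R i ∎
  where
  open ≡-Reasoning
  #up : count (λ j → leP R i j) ≡ suc (successors R i)
  #up = trans (count-cong λ j → cong (_∨ R i j) (⌊≟⌋-sym i j)) (count-insert (R i) (irrefl i))

altitude-iso : {R R' : Rel n} ((σ , _) : Iso R R') → ∀ k → altitude R' (σ ⟨$⟩ʳ k) ≡ altitude R k
altitude-iso {R = R} {R'} (σ , R≡R'σ) k =
  cong₂ (λ d u → ℤ.+ d ℤ.- ℤ.+ u)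
    (trans (sym (count-permute (λ j → leP R' j (σ ⟨$⟩ʳ k)) σ)) (count-cong λ j → leP-σ j k))
    (trans (sym (count-permute (leP R' (σ ⟨$⟩ʳ k)) σ)) (count-cong λ j → leP-σ k j))
  where
  leP-σ : ∀ i j → leP R' (σ ⟨$⟩ʳ i) (σ ⟨$⟩ʳ j) ≡ leP R i j
  leP-σ i j = cong₂ _∨_ (⌊⌋-⇔ (mk⇔ (Injection.injective (↔⇒↣ σ)) (cong (σ ⟨$⟩ʳ_))) _ _)
                        (sym (R≡R'σ i j))

⊖-≡-squeeze : ∀ {m m' n n'} → m ℕ.≤ m' → n' ℕ.≤ n → m ⊖ n ≡ m' ⊖ n' → m ≡ m' × n ≡ n'
⊖-≡-squeeze {m} {m'} {n} {n'} m≤m' n'≤n eq = m≡m' , n≡n'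
  where
  m≡m' : m ≡ m'
  m≡m' with ℕP.m≤n⇒m<n∨m≡n m≤m'
  ... | inj₂ m≡m' = m≡m'
  ... | inj₁ m<m' = contradiction eq
    (ℤP.<⇒≢ (ℤP.<-≤-trans (ℤP.⊖-monoˡ-< n m<m') (ℤP.⊖-monoʳ-≥-≤ m' n'≤n)))
  n≡n' : n ≡ n'
  n≡n' with ℕP.m≤n⇒m<n∨m≡n n'≤n
  ... | inj₂ n'≡n = sym n'≡n
  ... | inj₁ n'<n = contradiction eq
    (ℤP.<⇒≢ (ℤP.≤-<-trans (ℤP.⊖-monoˡ-≤ n m≤m') (ℤP.⊖-monoʳ->-< m' n'<n)))

module UnitIntervalOrder {R : Rel n} (uio : IsUnitIntervalOrder R) where

  private
    q : Fin n → ℚ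
    q = proj₁ uio

    related⇔ : ∀ i j → R i j ≡ true ⇔ q i ℚ.+ 1ℚ ℚ.< q j
    related⇔ = proj₂ uio

    p<p+1 : ∀ p → p ℚ.< p ℚ.+ 1ℚ
    p<p+1 p = subst (ℚ._< p ℚ.+ 1ℚ) (ℚP.+-identityʳ p) (ℚP.+-monoʳ-< p (ℚP.positive⁻¹ 1ℚ))

  irreflexive : ∀ i → R i i ≡ false
  irreflexive i = ¬-not λ Rii →
    ℚP.<-irrefl refl (ℚP.<-trans (Equivalence.to (related⇔ i i) Rii) (p<p+1 (q i)))

  predecessors-mono : ∀ {a b} → q a ℚ.≤ q b → (λ x → R x a) ⊆ᵇ (λ x → R x b)
  predecessors-mono {a} {b} qa≤qb x Rxa =
    Equivalence.from (related⇔ x b) (ℚP.<-≤-trans (Equivalence.to (related⇔ x a) Rxa) qa≤qb)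

  successors-antitone : ∀ {a b} → q a ℚ.≤ q b → R b ⊆ᵇ R a
  successors-antitone {a} {b} qa≤qb x Rbx =
    Equivalence.from (related⇔ a x)
      (ℚP.≤-<-trans (ℚP.+-monoˡ-≤ 1ℚ qa≤qb) (Equivalence.to (related⇔ b x) Rbx))

  private
    sameAltitude⇒twins-≤ : ∀ {a b} → q a ℚ.≤ q b → altitude R a ≡ altitude R b →
                           ∀ x → R x a ≡ R x b × R a x ≡ R b x
    sameAltitude⇒twins-≤ {a} {b} qa≤qb αa≡αb x =
        Bool-≡ true (mk⇔ (down x) (count-≡⇒⊇ down (proj₁ #≡) x))
      , Bool-≡ true (mk⇔ (count-≡⇒⊇ up (sym (proj₂ #≡)) x) (up x))
      where
      down = predecessors-mono qa≤qb
      up   = successors-antitone qa≤qb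
      α≡ = altitude-irreflexive irreflexive
      #≡ = ⊖-≡-squeeze (count-mono down) (count-mono up) (trans (sym (α≡ a)) (trans αa≡αb (α≡ b)))

  sameAltitude⇒twins : ∀ {a b} → altitude R a ≡ altitude R b →
                       ∀ x → R x a ≡ R x b × R a x ≡ R b x
  sameAltitude⇒twins {a} {b} αa≡αb x with ℚP.≤-total (q a) (q b)
  ... | inj₁ qa≤qb = sameAltitude⇒twins-≤ qa≤qb αa≡αb x
  ... | inj₂ qb≤qa =
    let Rxb≡Rxa , Rbx≡Rax = sameAltitude⇒twins-≤ qb≤qa (sym αa≡αb) x in sym Rxb≡Rxa , sym Rbx≡Rax

-- Sorting and canonical labelings

module Sorting {c ℓ₁ ℓ₂} (O : DecTotalOrder c ℓ₁ ℓ₂) where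

  open DecTotalOrder O renaming (Carrier to A; refl to ≤-refl; trans to ≤-trans)

  Sorted : (Fin n → A) → Set _
  Sorted f = f Preserves F._≤_ ⟶ _≤_

  argmin : (f : Fin (suc m) → A) → ∃ λ k → ∀ i → f k ≤ f i
  argmin {zero}  f = zero , λ { zero → ≤-refl }
  argmin {suc m} f with argmin (f ∘ suc)
  ... | k , fk≤ with total (f zero) (f (suc k))
  ...   | inj₁ f₀≤fk = zero  , λ { zero → ≤-refl ; (suc i) → ≤-trans f₀≤fk (fk≤ i) }
  ...   | inj₂ fk≤f₀ = suc k , λ { zero → fk≤f₀  ; (suc i) → fk≤ i }

  sortingPermutation : (f : Fin n → A) → ∃ λ (π : Permutation n n) → Sorted (f ∘ (π ⟨$⟩ʳ_))
  sortingPermutation {zero}  f = Perm.id , λ { {()} }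
  sortingPermutation {suc n} f = Perm.lift₀ ρ ∘ₚ τ , sorted
    where
    τ    = Perm.transpose zero (proj₁ (argmin f))
    rest = sortingPermutation (f ∘ (τ ⟨$⟩ʳ_) ∘ suc)
    ρ    = proj₁ rest
    sorted : Sorted (f ∘ ((Perm.lift₀ ρ ∘ₚ τ) ⟨$⟩ʳ_))
    sorted {zero}  {_}     _         = proj₂ (argmin f) _
    sorted {suc i} {suc j} (s≤s i≤j) = proj₂ rest i≤j

  private
    -- For sorted h the set {k : h k ≤ g i} is an initial segment, and g ∘ σ ≈ f makes its
    -- length the same for h = f and h = g.
    sorted-permute-≤ : {f g : Fin n → A} (σ : Permutation n n) → Sorted f → Sorted g →
                       (∀ k → g (σ ⟨$⟩ʳ k) ≈ f k) → ∀ i → f i ≤ g i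
    sorted-permute-≤ {f = f} {g} σ f↑ g↑ g∘σ≈f i =
      Equivalence.to (⌊⌋≡true⇔ (f i ≤? g i))
        (Equivalence.from (atMost-count f↑ i)
          (subst (toℕ i ℕ.<_) #atMost≡
            (Equivalence.to (atMost-count g↑ i) (Equivalence.from (⌊⌋≡true⇔ (g i ≤? g i)) ≤-refl))))
      where
      atMost : (Fin _ → A) → Fin _ → Bool
      atMost h k = ⌊ h k ≤? g i ⌋
      atMost-count : ∀ {h} → Sorted h → ∀ k → atMost h k ≡ true ⇔ toℕ k ℕ.< count (atMost h)
      atMost-count {h} h↑ = downwardClosed-count λ k≤l hl≤ →
        Equivalence.from (⌊⌋≡true⇔ _) (≤-trans (h↑ k≤l) (Equivalence.to (⌊⌋≡true⇔ _) hl≤))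
      #atMost≡ : count (atMost g) ≡ count (atMost f)
      #atMost≡ = trans (sym (count-permute (atMost g) σ)) (count-cong λ k →
        ⌊⌋-⇔ (mk⇔ (≤-respˡ-≈ (g∘σ≈f k)) (≤-respˡ-≈ (Eq.sym (g∘σ≈f k)))) _ _)

  sorted-permute-unique : {f g : Fin n → A} (σ : Permutation n n) → Sorted f → Sorted g →
                          (∀ k → g (σ ⟨$⟩ʳ k) ≈ f k) → ∀ i → f i ≈ g i
  sorted-permute-unique {g = g} σ f↑ g↑ g∘σ≈f i = antisym
    (sorted-permute-≤ σ f↑ g↑ g∘σ≈f i)
    (sorted-permute-≤ (Perm.flip σ) g↑ f↑
       (λ k → Eq.trans (Eq.sym (g∘σ≈f _)) (Eq.reflexive (cong g (Perm.inverseʳ σ)))) i)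

open Sorting ℤP.≤-decTotalOrder using (Sorted; sortingPermutation; sorted-permute-unique)

canonical⇔sorted : {R : Rel n} → Canonical R ⇔ Sorted (altitude R)
canonical⇔sorted {R = R} = mk⇔
  (λ canonical {i} {j} i≤j → ℤP.≮⇒≥ λ αj<αi → ℕP.<⇒≱ (canonical j i αj<αi) i≤j)
  (λ sorted i j αi<αj → ℕP.≰⇒> λ j≤i → ℤP.<⇒≱ αi<αj (sorted j≤i))

relabel : Rel n → Permutation n n → Rel n
relabel R π i j = R (π ⟨$⟩ʳ i) (π ⟨$⟩ʳ j)

relabel-isUnitIntervalOrder : {R : Rel n} (π : Permutation n n) →
                              IsUnitIntervalOrder R → IsUnitIntervalOrder (relabel R π)
relabel-isUnitIntervalOrder π (q , related⇔) =
  q ∘ (π ⟨$⟩ʳ_) , λ i j → related⇔ (π ⟨$⟩ʳ i) (π ⟨$⟩ʳ j)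

iso-relabel : (R : Rel n) (π : Permutation n n) → Iso R (relabel R π)
iso-relabel R π = Perm.flip π , λ i j → sym (cong₂ R (Perm.inverseʳ π) (Perm.inverseʳ π))

canonicalRelabeling : (R : Rel n) → ∃ λ π → Canonical (relabel R π)
canonicalRelabeling R = π , Equivalence.from canonical⇔sorted λ {i} {j} i≤j →
  subst₂ ℤ._≤_ (α-relabel i) (α-relabel j) (sorted i≤j)
  where
  π = proj₁ (sortingPermutation (altitude R))
  sorted = proj₂ (sortingPermutation (altitude R))
  α-relabel : ∀ k → altitude R (π ⟨$⟩ʳ k) ≡ altitude (relabel R π) k
  α-relabel = altitude-iso {R = relabel R π} {R' = R} (π , λ _ _ → refl)

canonicalLabeling : (R : Rel n) → IsUnitIntervalOrder R →
                    Σ (Rel n) λ R' → IsUnitIntervalOrder R' × Canonical R' × Iso R R'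
canonicalLabeling R uio =
  relabel R π , relabel-isUnitIntervalOrder π uio , canonical , iso-relabel R π
  where
  π = proj₁ (canonicalRelabeling R)
  canonical = proj₂ (canonicalRelabeling R)

canonical-iso⇒≡ : {R R' : Rel n} → IsUnitIntervalOrder R' → Canonical R → Canonical R' →
                  Iso R R' → ∀ i j → R i j ≡ R' i j
canonical-iso⇒≡ {R = R} {R'} uio' canonical canonical' iso@(σ , R≡R'σ) i j = begin
  R i j                         ≡⟨ R≡R'σ i j ⟩
  R' (σ ⟨$⟩ʳ i) (σ ⟨$⟩ʳ j)      ≡⟨ proj₂ (twins i (σ ⟨$⟩ʳ j)) ⟩
  R' i (σ ⟨$⟩ʳ j)               ≡⟨ proj₁ (twins j i) ⟩
  R' i j                        ∎
  where
  open ≡-Reasoning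
  α≡α' : ∀ k → altitude R k ≡ altitude R' k
  α≡α' = sorted-permute-unique σ (Equivalence.to (canonical⇔sorted {R = R}) canonical)
           (Equivalence.to (canonical⇔sorted {R = R'}) canonical') (altitude-iso {R = R} {R'} iso)
  twins : ∀ k x → R' x (σ ⟨$⟩ʳ k) ≡ R' x k × R' (σ ⟨$⟩ʳ k) x ≡ R' k x
  twins k = UnitIntervalOrder.sameAltitude⇒twins uio'
              (trans (altitude-iso {R = R} {R'} iso k) (α≡α' k))

-- Exchange bases of [ I ∣ B ]

sumℚ-cong : {f g : Fin m → ℚ} → (∀ k → f k ≡ g k) → sumℚ f ≡ sumℚ g
sumℚ-cong {zero}  _   = refl
sumℚ-cong {suc m} f≗g = cong₂ ℚ._+_ (f≗g zero) (sumℚ-cong (f≗g ∘ suc))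

sumℚ-zero : {f : Fin m → ℚ} → (∀ k → f k ≡ 0ℚ) → sumℚ f ≡ 0ℚ
sumℚ-zero {zero}  _  = refl
sumℚ-zero {suc m} f≗0 rewrite f≗0 zero = trans (ℚP.+-identityˡ _) (sumℚ-zero (f≗0 ∘ suc))

sumℚ-single : (f : Fin m → ℚ) (a : Fin m) → (∀ k → k ≢ a → f k ≡ 0ℚ) → sumℚ f ≡ f a
sumℚ-single {suc m} f zero    off =
  trans (cong (f zero ℚ.+_) (sumℚ-zero λ k → off (suc k) λ ())) (ℚP.+-identityʳ (f zero))
sumℚ-single {suc m} f (suc a) off rewrite off zero λ () =
  trans (ℚP.+-identityˡ _) (sumℚ-single (f ∘ suc) a λ k k≢a → off (suc k) (k≢a ∘ FP.suc-injective))

sumℚ-↑ : ∀ m {k} (f : Fin (m ℕ.+ k) → ℚ) → sumℚ f ≡ sumℚ (f ∘ (_↑ˡ k)) ℚ.+ sumℚ (f ∘ (m ↑ʳ_))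
sumℚ-↑ zero    f = sym (ℚP.+-identityˡ (sumℚ f))
sumℚ-↑ (suc m) f = trans (cong (f zero ℚ.+_) (sumℚ-↑ m (f ∘ suc))) (sym (ℚP.+-assoc (f zero) _ _))

↑-elim : ∀ {k} {P : Fin (m ℕ.+ k) → Set} → (∀ a → P (a ↑ˡ k)) → (∀ b → P (m ↑ʳ b)) → ∀ i → P i
↑-elim {zero}  _    right i       = right i
↑-elim {suc m} left _     zero    = left zero
↑-elim {suc m} left right (suc i) = ↑-elim (left ∘ suc) right i

*-≡0⇒≡0 : ∀ {x y} → y ≢ 0ℚ → x ℚ.* y ≡ 0ℚ → x ≡ 0ℚ
*-≡0⇒≡0 {x} {y} y≢0 xy≡0 = begin
  x                       ≡⟨ ℚP.*-identityʳ x ⟨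
  x ℚ.* 1ℚ                ≡⟨ cong (x ℚ.*_) (ℚP.*-inverseʳ y) ⟨
  x ℚ.* (y ℚ.* y⁻¹)       ≡⟨ ℚP.*-assoc x y y⁻¹ ⟨
  x ℚ.* y ℚ.* y⁻¹         ≡⟨ cong (ℚ._* y⁻¹) xy≡0 ⟩
  0ℚ ℚ.* y⁻¹              ≡⟨ ℚP.*-zeroˡ y⁻¹ ⟩
  0ℚ                      ∎
  where
  open ≡-Reasoning
  instance _ = ℚ.≢-nonZero y≢0
  y⁻¹ = ℚ.1/ y

LinIndepCols-cong : ∀ {k} {M M' : Fin n → Fin k → ℚ} {S} → (∀ i l → M i l ≡ M' i l) →
                    LinIndepCols M S → LinIndepCols M' S
LinIndepCols-cong M≗M' li c supported rows≡0 =
  li c supported λ i → trans (sumℚ-cong λ l → cong (c l ℚ.*_) (M≗M' i l)) (rows≡0 i)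

δ : Fin n → Fin n → ℚ
δ i a = if ⌊ i ≟ a ⌋ then 1ℚ else 0ℚ

δ-diag : {i : Fin n} → δ i i ≡ 1ℚ
δ-diag {i = i} with i ≟ i
... | yes _   = refl
... | no  i≢i = contradiction refl i≢i

δ-off : {i a : Fin n} → i ≢ a → δ i a ≡ 0ℚ
δ-off {i = i} {a} i≢a with i ≟ a
... | yes i≡a = contradiction i≡a i≢a
... | no  _   = refl

∣++∣ : ∀ {k} (p : Subset m) (q : Subset k) → ∣ p Vec.++ q ∣ ≡ ∣ p ∣ ℕ.+ ∣ q ∣
∣++∣ Vec.[]             q = refl
∣++∣ (inside  Vec.∷ p) q = cong suc (∣++∣ p q)
∣++∣ (outside Vec.∷ p) q = ∣++∣ p q

∈-++ˡ : ∀ {k} {p : Subset m} {q : Subset k} {a} → a ↑ˡ k ∈ p Vec.++ q ⇔ a ∈ p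
∈-++ˡ {p = p} {q} {a} = mk⇔
  (λ a∈ → VecP.lookup⇒[]= a p (trans (sym (VecP.lookup-++ˡ p q a)) (VecP.[]=⇒lookup a∈)))
  (λ a∈ → VecP.lookup⇒[]= _ (p Vec.++ q) (trans (VecP.lookup-++ˡ p q a) (VecP.[]=⇒lookup a∈)))

∈-++ʳ : ∀ {k} {p : Subset m} {q : Subset k} {b} → m ↑ʳ b ∈ p Vec.++ q ⇔ b ∈ q
∈-++ʳ {p = p} {q} {b} = mk⇔
  (λ b∈ → VecP.lookup⇒[]= b q (trans (sym (VecP.lookup-++ʳ p q b)) (VecP.[]=⇒lookup b∈)))
  (λ b∈ → VecP.lookup⇒[]= _ (p Vec.++ q) (trans (VecP.lookup-++ʳ p q b) (VecP.[]=⇒lookup b∈)))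

exchange : Fin n → Fin n → Subset (n ℕ.+ n)
exchange r j = ∁ ⁅ r ⁆ Vec.++ ⁅ j ⁆

∣exchange∣ : (r j : Fin n) → ∣ exchange r j ∣ ≡ n
∣exchange∣ {suc n} r j = begin
  ∣ ∁ ⁅ r ⁆ Vec.++ ⁅ j ⁆ ∣  ≡⟨ ∣++∣ (∁ ⁅ r ⁆) ⁅ j ⁆ ⟩
  ∣ ∁ ⁅ r ⁆ ∣ ℕ.+ ∣ ⁅ j ⁆ ∣ ≡⟨ cong₂ ℕ._+_ (∣∁p∣≡n∸∣p∣ ⁅ r ⁆) (∣⁅x⁆∣≡1 j) ⟩
  suc n ℕ.∸ ∣ ⁅ r ⁆ ∣ ℕ.+ 1 ≡⟨ cong (λ s → suc n ℕ.∸ s ℕ.+ 1) (∣⁅x⁆∣≡1 r) ⟩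
  n ℕ.+ 1                   ≡⟨ ℕP.+-comm n 1 ⟩
  suc n                     ∎
  where open ≡-Reasoning

module ExchangeBasis (N : Fin n → Fin (n ℕ.+ n) → ℚ) (N-↑ˡ : ∀ i a → N i (a ↑ˡ n) ≡ δ i a)
                     (r j : Fin n) where

  open ≡-Reasoning

  J : Fin (n ℕ.+ n)
  J = n ↑ʳ j

  row-sum : (c : Fin (n ℕ.+ n) → ℚ) → (∀ b → b ≢ j → c (n ↑ʳ b) ≡ 0ℚ) →
            ∀ i → sumℚ (λ k → c k ℚ.* N i k) ≡ c (i ↑ˡ n) ℚ.+ c J ℚ.* N i J
  row-sum c c-off i = begin
    sumℚ (λ k → c k ℚ.* N i k)
      ≡⟨ sumℚ-↑ n _ ⟩
    sumℚ (λ a → c (a ↑ˡ n) ℚ.* N i (a ↑ˡ n)) ℚ.+ sumℚ (λ b → c (n ↑ʳ b) ℚ.* N i (n ↑ʳ b))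
      ≡⟨ cong₂ ℚ._+_ (sumℚ-single _ i left-off) (sumℚ-single _ j right-off) ⟩
    c (i ↑ˡ n) ℚ.* N i (i ↑ˡ n) ℚ.+ c J ℚ.* N i J
      ≡⟨ cong (λ x → c (i ↑ˡ n) ℚ.* x ℚ.+ c J ℚ.* N i J) (trans (N-↑ˡ i i) δ-diag) ⟩
    c (i ↑ˡ n) ℚ.* 1ℚ ℚ.+ c J ℚ.* N i J
      ≡⟨ cong (ℚ._+ c J ℚ.* N i J) (ℚP.*-identityʳ (c (i ↑ˡ n))) ⟩
    c (i ↑ˡ n) ℚ.+ c J ℚ.* N i J ∎
    where
    left-off : ∀ a → a ≢ i → c (a ↑ˡ n) ℚ.* N i (a ↑ˡ n) ≡ 0ℚ
    left-off a a≢i = trans (cong (c (a ↑ˡ n) ℚ.*_) (trans (N-↑ˡ i a) (δ-off (a≢i ∘ sym))))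
                           (ℚP.*-zeroʳ (c (a ↑ˡ n)))
    right-off : ∀ b → b ≢ j → c (n ↑ʳ b) ℚ.* N i (n ↑ʳ b) ≡ 0ℚ
    right-off b b≢j = trans (cong (ℚ._* N i (n ↑ʳ b)) (c-off b b≢j)) (ℚP.*-zeroˡ (N i (n ↑ʳ b)))

  independent : N r J ≢ 0ℚ → LinIndepCols N (exchange r j)
  independent NrJ≢0 c supported rows≡0 = ↑-elim c-left≡0 c-right≡0
    where
    c-off : ∀ b → b ≢ j → c (n ↑ʳ b) ≡ 0ℚ
    c-off b b≢j = supported _ (b≢j ∘ x∈⁅y⁆⇒x≡y j ∘ Equivalence.to ∈-++ʳ)
    row : ∀ i → c (i ↑ˡ n) ℚ.+ c J ℚ.* N i J ≡ 0ℚ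
    row i = trans (sym (row-sum c c-off i)) (rows≡0 i)
    c-r≡0 : c (r ↑ˡ n) ≡ 0ℚ
    c-r≡0 = supported _ λ r∈ → x∈∁p⇒x∉p (Equivalence.to ∈-++ˡ r∈) (x∈⁅x⁆ r)
    c-J≡0 : c J ≡ 0ℚ
    c-J≡0 = *-≡0⇒≡0 NrJ≢0 (begin
      c J ℚ.* N r J                  ≡⟨ ℚP.+-identityˡ _ ⟨
      0ℚ ℚ.+ c J ℚ.* N r J           ≡⟨ cong (ℚ._+ c J ℚ.* N r J) c-r≡0 ⟨
      c (r ↑ˡ n) ℚ.+ c J ℚ.* N r J   ≡⟨ row r ⟩
      0ℚ                             ∎)
    c-left≡0 : ∀ a → c (a ↑ˡ n) ≡ 0ℚ
    c-left≡0 a = begin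
      c (a ↑ˡ n)                     ≡⟨ ℚP.+-identityʳ _ ⟨
      c (a ↑ˡ n) ℚ.+ 0ℚ              ≡⟨ cong (c (a ↑ˡ n) ℚ.+_) cJ·NaJ≡0 ⟨
      c (a ↑ˡ n) ℚ.+ c J ℚ.* N a J   ≡⟨ row a ⟩
      0ℚ                             ∎
      where cJ·NaJ≡0 = trans (cong (ℚ._* N a J) c-J≡0) (ℚP.*-zeroˡ (N a J))
    c-right≡0 : ∀ b → c (n ↑ʳ b) ≡ 0ℚ
    c-right≡0 b with b ≟ j
    ... | yes refl = c-J≡0
    ... | no  b≢j  = c-off b b≢j

  dependent : N r J ≡ 0ℚ → ¬ LinIndepCols N (exchange r j)
  dependent NrJ≡0 li = ℚP.1≢0 (trans (sym c-J) (li c supported rows≡0 J))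
    where
    -- c = e_J − Σₐ N a J · e_a; its coefficient −N r J at r ↑ˡ n vanishes, so c lives on the
    -- exchange set.
    left right : Fin n → ℚ
    left a  = ℚ.- N a J
    right b = δ b j
    c : Fin (n ℕ.+ n) → ℚ
    c = left VF.++ right
    c-J : c J ≡ 1ℚ
    c-J = trans (VFP.lookup-++ʳ left right j) δ-diag
    c-off : ∀ b → b ≢ j → c (n ↑ʳ b) ≡ 0ℚ
    c-off b b≢j = trans (VFP.lookup-++ʳ left right b) (δ-off b≢j)
    supported : ∀ k → k ∉ exchange r j → c k ≡ 0ℚ
    supported = ↑-elim
      (λ a a∉ → trans (VFP.lookup-++ˡ left right a)
                      (cong ℚ.-_ (trans (cong (λ x → N x J) (∉exchange⇒≡r a∉)) NrJ≡0)))
      (λ b b∉ → c-off b (x∉⁅y⁆⇒x≢y (b∉ ∘ Equivalence.from ∈-++ʳ)))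
      where
      ∉exchange⇒≡r : ∀ {a} → a ↑ˡ n ∉ exchange r j → a ≡ r
      ∉exchange⇒≡r a∉ = x∈⁅y⁆⇒x≡y r (x∉∁p⇒x∈p (a∉ ∘ Equivalence.from ∈-++ˡ))
    rows≡0 : ∀ i → sumℚ (λ k → c k ℚ.* N i k) ≡ 0ℚ
    rows≡0 i = begin
      sumℚ (λ k → c k ℚ.* N i k)      ≡⟨ row-sum c c-off i ⟩
      c (i ↑ˡ n) ℚ.+ c J ℚ.* N i J    ≡⟨ cong₂ ℚ._+_ (VFP.lookup-++ˡ left right i) cJ·NiJ≡NiJ ⟩
      ℚ.- N i J ℚ.+ N i J             ≡⟨ ℚP.+-inverseˡ (N i J) ⟩
      0ℚ                              ∎
      where cJ·NiJ≡NiJ = trans (cong (ℚ._* N i J) c-J) (ℚP.*-identityˡ (N i J))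

  independent⇔ : LinIndepCols N (exchange r j) ⇔ N r J ≢ 0ℚ
  independent⇔ = mk⇔ (λ li NrJ≡0 → dependent NrJ≡0 li) independent

-- The positroid determines the order

ψ-↑ˡ : (A : Fin n → Fin n → ℚ) → ∀ i a → ψ A i (a ↑ˡ n) ≡ δ i a
ψ-↑ˡ {n} A i a rewrite FP.splitAt-↑ˡ n a n = refl

ψ-↑ʳ : (A : Fin n → Fin n → ℚ) → ∀ i b →
       ψ A i (n ↑ʳ b) ≡ negOnePow (toℕ (opposite i)) ℚ.* A (opposite i) b
ψ-↑ʳ {n} A i b rewrite FP.splitAt-↑ʳ n n b = refl

ψ-cong : {A B : Fin n → Fin n → ℚ} → (∀ i j → A i j ≡ B i j) → ∀ i k → ψ A i k ≡ ψ B i k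
ψ-cong {n} A≗B i k with splitAt n k
... | inj₁ _ = refl
... | inj₂ b = cong (negOnePow (toℕ (opposite i)) ℚ.*_) (A≗B (opposite i) b)

negOnePow≢0 : ∀ k → negOnePow k ≢ 0ℚ
negOnePow≢0 zero    = ℚP.1≢0
negOnePow≢0 (suc k) = negOnePow≢0 k ∘ ℚP.neg-injective

signed-antiadj≡0⇔ : ∀ k b → negOnePow k ℚ.* (if b then 0ℚ else 1ℚ) ≡ 0ℚ ⇔ b ≡ true
signed-antiadj≡0⇔ k true  = mk⇔ (λ _ → refl) (λ _ → ℚP.*-zeroʳ (negOnePow k))
signed-antiadj≡0⇔ k false =
  mk⇔ (λ ±1≡0 → contradiction (trans (sym (ℚP.*-identityʳ (negOnePow k))) ±1≡0) (negOnePow≢0 k)) λ ()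

ψ-antiadj-↑ʳ≡0⇔ : (R : Rel n) (r j : Fin n) →
                  ψ (antiadj R) r (n ↑ʳ j) ≡ 0ℚ ⇔ R (opposite r) j ≡ true
ψ-antiadj-↑ʳ≡0⇔ R r j rewrite ψ-↑ʳ (antiadj R) r j =
  signed-antiadj≡0⇔ (toℕ (opposite r)) (R (opposite r) j)

positroid-exchange⇔ : (R : Rel n) (r j : Fin n) →
                      positroid R (exchange r j) ⇔ R (opposite r) j ≡ false
positroid-exchange⇔ R r j = mk⇔
  (λ (_ , li) → ¬-not (Equivalence.to independent⇔ li ∘ Equivalence.from ψ≡0⇔))
  (λ Rrj≡false → ∣exchange∣ r j ,
                 Equivalence.from independent⇔ (not-¬ Rrj≡false ∘ Equivalence.to ψ≡0⇔))
  where
  open ExchangeBasis (ψ (antiadj R)) (ψ-↑ˡ (antiadj R)) r j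
  ψ≡0⇔ = ψ-antiadj-↑ʳ≡0⇔ R r j

positroid-injective : {R R' : Rel n} → SameMatroid n (positroid R) (positroid R') →
                      ∀ i j → R i j ≡ R' i j
positroid-injective {R = R} {R'} same i j =
  subst (λ x → R x j ≡ R' x j) (FP.opposite-involutive i) (Bool-≡ false
    (⇔.trans (⇔.sym (positroid-exchange⇔ R (opposite i) j))
      (⇔.trans (same (exchange (opposite i) j)) (positroid-exchange⇔ R' (opposite i) j))))

positroid-cong : {R R' : Rel n} → (∀ i j → R i j ≡ R' i j) →
                 SameMatroid n (positroid R) (positroid R')
positroid-cong R≗R' S =
  mk⇔ (map₂ (LinIndepCols-cong ψ≗)) (map₂ (LinIndepCols-cong λ i k → sym (ψ≗ i k)))
  where ψ≗ = ψ-cong λ i j → cong (λ b → if b then 0ℚ else 1ℚ) (R≗R' i j)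

theorem5p4 : (n : ℕ) →
    -- every unit interval order on n elements has a canonical labeling
    ((R : Rel n) → IsUnitIntervalOrder R →
      Σ (Rel n) λ R' → IsUnitIntervalOrder R' × Canonical R' × Iso R R')
    -- well-defined and injective on isomorphism classes
    × ((R R' : Rel n) → IsUnitIntervalOrder R → IsUnitIntervalOrder R' →
      Canonical R → Canonical R' →
      (Iso R R' ⇔ SameMatroid n (positroid R) (positroid R')))
    -- surjective onto 𝒫_n
    × ((M : Matroid n) → InP n M →
      Σ (Rel n) λ R → IsUnitIntervalOrder R × Canonical R
        × SameMatroid n (positroid R) M)
theorem5p4 n =
    canonicalLabeling
  , (λ R R' _ uio' canonical canonical' → mk⇔
      (positroid-cong ∘ canonical-iso⇒≡ uio' canonical canonical')
      (λ same → Perm.id , positroid-injective same))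
  , λ _ inP → inP
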